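{- Let $q=p^m$ be a power of a prime $p$. For a positive integer $d$ define $$g_q(d)=\prod_{\ell\ \text{prime},\ \ell\ne p,\ e_q(\ell)=d}\left(1-\frac{1}{\ell}\right),$$ with $g_q(d)=1$ if the product is empty. Then there is a constant $C>0$ (independent of $d$) such that for every integer $d\ge2$, $$0\le 1-g_q(d)\le\sum_{\ell\ \text{prime},\ e_q(\ell)=d}\frac{1}{\ell}\le C\,\frac{\log d}{d}.$$ In particular, $\lim_{d\to+\infty}g_q(d)=1$ and the series $\sum_{d=1}^{\infty}\frac{1-g_q(d)}{d}$ converges.
   Context: For coprime positive integers $a,b$, $e_a(b)$ denotes the multiplicative order of $a$ modulo $b$, i.e. the least $k\ge1$ with $a^k\equiv1\pmod b$. -}

module Defs where

open import Data.Nat as ℕ using (ℕ; zero; suc; _^_; _∸_; _<_; _≤_)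
open import Data.Nat.Divisibility using (_∣_)
open import Data.Nat.Primality using (Prime)
open import Data.Integer using (+_)
open import Data.Rational using (ℚ; _/_; _+_; _*_; 0ℚ; 1ℚ)
open import Data.List using (List; foldr)
open import Data.List.Membership.Propositional using (_∈_)
open import Data.List.Relation.Unary.Unique.Propositional using (Unique)
open import Data.Product using (_×_)
open import Relation.Nullary using (¬_)
open import Function.Bundles using (_⇔_)

-- e_a(b) = k : k is the multiplicative order of a modulo b,
-- i.e. k ≥ 1, b ∣ a^k - 1, and no 1 ≤ j < k has b ∣ a^j - 1.
-- (For b ≥ 2 with b ∣ a^k - 1 this forces gcd(a,b) = 1.)
IsOrder : ℕ → ℕ → ℕ → Set
IsOrder a b k = (1 ≤ k) × (b ∣ (a ^ k ∸ 1)) × (∀ j → 1 ≤ j → j < k → ¬ (b ∣ (a ^ j ∸ 1)))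

InG : ℕ → ℕ → ℕ → ℕ → Set
InG p q d ℓ = Prime ℓ × ¬ (ℓ ≡ p) × IsOrder q ℓ d
  where open import Relation.Binary.PropositionalEquality using (_≡_)

-- L is a duplicate-free list enumerating exactly the set {ℓ | P ℓ}
-- (this set is finite: every such ℓ divides q^d - 1 > 0 when q ≥ 2).
Enumerates : (ℕ → Set) → List ℕ → Set
Enumerates P L = Unique L × (∀ ℓ → (ℓ ∈ L) ⇔ P ℓ)

-- 1/n as a rational (with 1/0 := 0, never used on primes)
inv : ℕ → ℚ
inv zero = 0ℚ
inv (suc n) = + 1 / suc n

sumInv : List ℕ → ℚ
sumInv = foldr (λ ℓ s → inv ℓ + s) 0ℚ

prodG : List ℕ → ℚ
prodG = foldr (λ ℓ r → (1ℚ Data.Rational.- inv ℓ) * r) 1ℚ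

sumTo : ℕ → (ℕ → ℚ) → ℚ
sumTo zero f = 0ℚ
sumTo (suc N) f = sumTo N f + f (suc N)

module Submission where

-- A prime ℓ ≠ p with e_q(ℓ) = d divides q^d - 1, and d ∣ ℓ - 1 by Fermat's little
-- theorem, so ℓ = 1 + dj with j ≥ 1.  These primes are distinct divisors of q^d - 1 < 2^(qd), so
-- there are fewer than qd of them, and distinct indices j give
--     Σ 1/ℓ ≤ (1/d)·Σ 1/j ≤ H_{qd} / d.
-- A dyadic bound gives H_{qd} ≤ q + 1 + log₂ d ≤ (q + 2)·log₂ d; with the Weierstrass product
-- inequality 1 - ∏(1 - x_i) ≤ Σ x_i this is the first claim, and the limit follows since
-- log₂ d / d → 0.  For the series, the potential Φ(d) = 2(H_{qd} + 2)/d satisfies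
-- H_{qd}/d² + Φ(d+1) ≤ Φ(d), so every partial sum is at most Φ(1).

module NumberTheory where

  open import Defs using (IsOrder)
  open import Data.Nat
  open import Data.Nat.Properties
  open import Data.Nat.Divisibility
  open import Data.Nat.DivMod
  open import Data.Nat.Primality
  open import Data.Nat.Primality.Factorisation using (factorisationHasAllPrimeFactors)
  open import Data.Nat.Coprimality using (Coprime; coprime-divisor)
  open import Data.Nat.Combinatorics using (_C_; nCn≡1; nC1≡n; k>n⇒nCk≡0; nCk+nC[k+1]≡[n+1]C[k+1])
  open import Data.Nat.ListAction using (product)
  open import Data.Nat.Solver using (module +-*-Solver)
  open +-*-Solver using (solve; _:+_; _:*_; _:=_; con)
  open import Data.List using (List; []; _∷_; length)
  open import Data.List.Relation.Unary.All as All using (All; []; _∷_)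
  open import Data.List.Relation.Unary.All.Properties using (All¬⇒¬Any)
  open import Data.List.Relation.Unary.Unique.Propositional using (Unique)
  open import Data.List.Relation.Unary.AllPairs using ([]; _∷_)
  open import Data.Product using (_×_; _,_; ∃-syntax)
  open import Data.Sum using (inj₁; inj₂)
  open import Data.Empty using (⊥-elim)
  open import Function using (_∘_)
  open import Relation.Nullary using (¬_)
  open import Relation.Binary.PropositionalEquality

  Σ< : ℕ → (ℕ → ℕ) → ℕ
  Σ< zero    f = 0
  Σ< (suc n) f = Σ< n f + f n

  Σ<-head : ∀ n f → Σ< (suc n) f ≡ f 0 + Σ< n (f ∘ suc)
  Σ<-head zero    f = +-comm 0 (f 0)
  Σ<-head (suc n) f = trans (cong (_+ f (suc n)) (Σ<-head n f)) (+-assoc (f 0) _ _)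

  Σ<-cong : ∀ n {f g} → (∀ k → f k ≡ g k) → Σ< n f ≡ Σ< n g
  Σ<-cong zero    eq = refl
  Σ<-cong (suc n) eq = cong₂ _+_ (Σ<-cong n eq) (eq n)

  Σ<-+ : ∀ n f g → Σ< n (λ k → f k + g k) ≡ Σ< n f + Σ< n g
  Σ<-+ zero    f g = refl
  Σ<-+ (suc n) f g = trans (cong (_+ (f n + g n)) (Σ<-+ n f g))
    (solve 4 (λ a b c d → (a :+ b) :+ (c :+ d) := (a :+ c) :+ (b :+ d)) refl (Σ< n f) (Σ< n g) (f n) (g n))

  Σ<-*ˡ : ∀ n c f → Σ< n (λ k → c * f k) ≡ c * Σ< n f
  Σ<-*ˡ zero    c f = sym (*-zeroʳ c)
  Σ<-*ˡ (suc n) c f = trans (cong (_+ c * f n) (Σ<-*ˡ n c f)) (sym (*-distribˡ-+ c (Σ< n f) (f n)))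

  Σ<-∣ : ∀ n {d} f → (∀ k → k < n → d ∣ f k) → d ∣ Σ< n f
  Σ<-∣ zero    {d} f h = d ∣0
  Σ<-∣ (suc n) f h = ∣m∣n⇒∣m+n (Σ<-∣ n f (λ k k<n → h k (m<n⇒m<1+n k<n))) (h n ≤-refl)

  C-absorb : ∀ n k → suc k * (suc n C suc k) ≡ suc n * (n C k)
  C-absorb zero    zero    = refl
  C-absorb zero    (suc k) = *-zeroʳ (suc (suc k))
  C-absorb (suc n) zero    = trans (*-identityˡ _) (trans (nC1≡n (suc (suc n))) (sym (*-identityʳ _)))
  C-absorb (suc n) (suc k) = begin
      suc (suc k) * (suc (suc n) C suc (suc k))
        ≡⟨ cong (suc (suc k) *_) (sym (nCk+nC[k+1]≡[n+1]C[k+1] (suc n) (suc k))) ⟩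
      suc (suc k) * (a + b)
        ≡⟨ solve 3 (λ k a b → (con 2 :+ k) :* (a :+ b) := ((con 1 :+ k) :* a :+ a) :+ (con 2 :+ k) :* b) refl k a b ⟩
      (suc k * a + a) + suc (suc k) * b
        ≡⟨ cong₂ (λ s t → (s + a) + t) (C-absorb n k) (C-absorb n (suc k)) ⟩
      (suc n * u + a) + suc n * v
        ≡⟨ cong (λ z → (suc n * u + z) + suc n * v) (sym (nCk+nC[k+1]≡[n+1]C[k+1] n k)) ⟩
      (suc n * u + (u + v)) + suc n * v
        ≡⟨ solve 3 (λ n u v → ((con 1 :+ n) :* u :+ (u :+ v)) :+ (con 1 :+ n) :* v := (con 2 :+ n) :* (u :+ v)) refl n u v ⟩
      suc (suc n) * (u + v)
        ≡⟨ cong (suc (suc n) *_) (nCk+nC[k+1]≡[n+1]C[k+1] n k) ⟩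
      suc (suc n) * (suc n C suc k) ∎
    where
    open ≡-Reasoning
    a : ℕ
    a = suc n C suc k
    b : ℕ
    b = suc n C suc (suc k)
    u : ℕ
    u = n C k
    v : ℕ
    v = n C suc k

  binomial-theorem : ∀ x n → suc x ^ n ≡ Σ< (suc n) (λ k → (n C k) * x ^ k)
  binomial-theorem x zero    = refl
  binomial-theorem x (suc n) = sym (begin
      Σ< (suc (suc n)) (λ k → (suc n C k) * x ^ k)
        ≡⟨ Σ<-head (suc n) _ ⟩
      1 + Σ< (suc n) (λ k → (suc n C suc k) * x ^ suc k)
        ≡⟨ cong (1 +_) (Σ<-cong (suc n) pascal) ⟩
      1 + Σ< (suc n) (λ k → x * term k + term (suc k))
        ≡⟨ cong (1 +_) (trans (Σ<-+ (suc n) _ _) (cong (_+ T) (Σ<-*ˡ (suc n) x term))) ⟩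
      1 + (x * S + T)
        ≡⟨ solve 2 (λ a b → con 1 :+ (a :+ b) := a :+ (con 1 :+ b)) refl (x * S) T ⟩
      x * S + (1 + T)
        ≡⟨ cong (x * S +_) (sym (Σ<-head (suc n) term)) ⟩
      x * S + Σ< (suc (suc n)) term
        ≡⟨ cong (x * S +_) last-vanishes ⟩
      x * S + S
        ≡⟨ +-comm (x * S) S ⟩
      suc x * S
        ≡⟨ cong (suc x *_) (sym (binomial-theorem x n)) ⟩
      suc x ^ suc n ∎)
    where
    open ≡-Reasoning
    term : ℕ → ℕ
    term k = (n C k) * x ^ k
    S : ℕ
    S = Σ< (suc n) term
    T : ℕ
    T = Σ< (suc n) (term ∘ suc)
    pascal : ∀ k → (suc n C suc k) * x ^ suc k ≡ x * term k + term (suc k)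
    pascal k = begin
      (suc n C suc k) * (x * x ^ k)
        ≡⟨ cong (_* (x * x ^ k)) (sym (nCk+nC[k+1]≡[n+1]C[k+1] n k)) ⟩
      (n C k + n C suc k) * (x * x ^ k)
        ≡⟨ solve 4 (λ a b x y → (a :+ b) :* (x :* y) := x :* (a :* y) :+ b :* (x :* y)) refl (n C k) (n C suc k) x (x ^ k) ⟩
      x * term k + term (suc k) ∎
    last-vanishes : Σ< (suc (suc n)) term ≡ S
    last-vanishes = trans (cong (λ c → S + c * x ^ suc n) (k>n⇒nCk≡0 (n<1+n n))) (+-identityʳ S)

  prime≥2 : ∀ {p} → Prime p → 2 ≤ p
  prime≥2 {p} pr = nonTrivial⇒n>1 p {{prime⇒nonTrivial pr}}

  -- A prime ℓ = n+1 divides the inner binomial coefficients C(ℓ, k+1), k+1 < ℓ, by absorption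
  -- and Euclid's lemma.
  prime∣C : ∀ n → Prime (suc n) → ∀ k → k < n → suc n ∣ suc n C suc k
  prime∣C n pr k k<n with euclidsLemma (suc k) (suc n C suc k) pr
                            (divides (n C k) (trans (C-absorb n k) (*-comm (suc n) (n C k))))
  ... | inj₁ ℓ∣1+k = ⊥-elim (<⇒≱ (s≤s k<n) (∣⇒≤ ℓ∣1+k))
  ... | inj₂ ℓ∣C   = ℓ∣C

  freshmans-dream : ∀ ℓ → Prime ℓ → ∀ x → ∃[ M ] (ℓ ∣ M × suc x ^ ℓ ≡ 1 + M + x ^ ℓ)
  freshmans-dream zero    pr x = ⊥-elim (<⇒≱ (prime≥2 pr) z≤n)
  freshmans-dream (suc n) pr x = M , ℓ∣M , expansion
    where
    term : ℕ → ℕ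
    term k = (suc n C k) * x ^ k
    M : ℕ
    M = Σ< n (λ k → term (suc k))
    ℓ∣M : suc n ∣ M
    ℓ∣M = Σ<-∣ n _ (λ k k<n → ∣m⇒∣m*n (x ^ suc k) (prime∣C n pr k k<n))
    expansion : suc x ^ suc n ≡ 1 + M + x ^ suc n
    expansion = trans (binomial-theorem x (suc n))
      (cong₂ _+_ (Σ<-head n term) (trans (cong (_* x ^ suc n) (nCn≡1 (suc n))) (*-identityˡ _)))

  fermat : ∀ n → Prime (suc n) → ∀ x → (x ^ suc n) % suc n ≡ x % suc n
  fermat n pr zero    = refl
  fermat n pr (suc x) with freshmans-dream (suc n) pr x
  ... | M , ℓ∣M , expansion = begin
      suc x ^ ℓ % ℓ             ≡⟨ cong (_% ℓ) expansion ⟩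
      (1 + M + x ^ ℓ) % ℓ       ≡⟨ cong (_% ℓ) (solve 3 (λ o m y → o :+ m :+ y := m :+ (o :+ y)) refl 1 M (x ^ ℓ)) ⟩
      (M + (1 + x ^ ℓ)) % ℓ     ≡⟨ %-remove-+ˡ (1 + x ^ ℓ) ℓ∣M ⟩
      (1 + x ^ ℓ) % ℓ           ≡⟨ %-distribˡ-+ 1 (x ^ ℓ) ℓ ⟩
      (1 % ℓ + x ^ ℓ % ℓ) % ℓ   ≡⟨ cong (λ z → (1 % ℓ + z) % ℓ) (fermat n pr x) ⟩
      (1 % ℓ + x % ℓ) % ℓ       ≡⟨ sym (%-distribˡ-+ 1 x ℓ) ⟩
      suc x % ℓ ∎
    where
    open ≡-Reasoning
    ℓ : ℕ
    ℓ = suc n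

  module _ {ℓ : ℕ} .{{_ : NonZero ℓ}} where

    %≡⇒∣∸ : ∀ a b → a % ℓ ≡ b % ℓ → ℓ ∣ a ∸ b
    %≡⇒∣∸ a b h = divides (a / ℓ ∸ b / ℓ) (begin
        a ∸ b                                        ≡⟨ cong₂ _∸_ (m≡m%n+[m/n]*n a ℓ) (m≡m%n+[m/n]*n b ℓ) ⟩
        (a % ℓ + (a / ℓ) * ℓ) ∸ (b % ℓ + (b / ℓ) * ℓ) ≡⟨ cong (λ z → (a % ℓ + (a / ℓ) * ℓ) ∸ (z + (b / ℓ) * ℓ)) (sym h) ⟩
        (a % ℓ + (a / ℓ) * ℓ) ∸ (a % ℓ + (b / ℓ) * ℓ) ≡⟨ [m+n]∸[m+o]≡n∸o (a % ℓ) _ _ ⟩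
        (a / ℓ) * ℓ ∸ (b / ℓ) * ℓ                    ≡⟨ sym (*-distribʳ-∸ ℓ (a / ℓ) (b / ℓ)) ⟩
        (a / ℓ ∸ b / ℓ) * ℓ ∎)
      where open ≡-Reasoning

    ∣∸1⇒%≡1 : ∀ a → 1 < ℓ → 1 ≤ a → ℓ ∣ a ∸ 1 → a % ℓ ≡ 1
    ∣∸1⇒%≡1 a 1<ℓ 1≤a (divides j eq) = begin
        a % ℓ               ≡⟨ cong (_% ℓ) (sym (m+[n∸m]≡n 1≤a)) ⟩
        (1 + (a ∸ 1)) % ℓ   ≡⟨ cong (λ z → (1 + z) % ℓ) eq ⟩
        (1 + j * ℓ) % ℓ     ≡⟨ [m+kn]%n≡m%n 1 j ℓ ⟩
        1 % ℓ               ≡⟨ m<n⇒m%n≡m 1<ℓ ⟩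
        1 ∎
      where open ≡-Reasoning

    %≡1⇒*-% : ∀ a b → a % ℓ ≡ 1 → (a * b) % ℓ ≡ b % ℓ
    %≡1⇒*-% a b h = begin
        (a * b) % ℓ               ≡⟨ %-distribˡ-* a b ℓ ⟩
        ((a % ℓ) * (b % ℓ)) % ℓ   ≡⟨ cong (λ z → (z * (b % ℓ)) % ℓ) h ⟩
        (1 * (b % ℓ)) % ℓ         ≡⟨ cong (_% ℓ) (*-identityˡ (b % ℓ)) ⟩
        (b % ℓ) % ℓ               ≡⟨ m%n%n≡m%n b ℓ ⟩
        b % ℓ ∎
      where open ≡-Reasoning

    %≡1⇒^%≡1 : ∀ a s → 1 < ℓ → a % ℓ ≡ 1 → (a ^ s) % ℓ ≡ 1
    %≡1⇒^%≡1 a zero    1<ℓ h = m<n⇒m%n≡m 1<ℓ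
    %≡1⇒^%≡1 a (suc s) 1<ℓ h = trans (%≡1⇒*-% a (a ^ s) h) (%≡1⇒^%≡1 a s 1<ℓ h)

  ^-reduce : ∀ {ℓ} .{{_ : NonZero ℓ}} q d .{{_ : NonZero d}} → 1 < ℓ → (q ^ d) % ℓ ≡ 1 →
             ∀ a → (q ^ a) % ℓ ≡ (q ^ (a % d)) % ℓ
  ^-reduce {ℓ} q d 1<ℓ qᵈ≡1 a = begin
      q ^ a % ℓ                               ≡⟨ cong (λ e → q ^ e % ℓ) (m≡m%n+[m/n]*n a d) ⟩
      q ^ (a % d + a / d * d) % ℓ             ≡⟨ cong (_% ℓ) (^-distribˡ-+-* q (a % d) (a / d * d)) ⟩
      q ^ (a % d) * q ^ (a / d * d) % ℓ       ≡⟨ cong (λ e → q ^ (a % d) * q ^ e % ℓ) (*-comm (a / d) d) ⟩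
      q ^ (a % d) * q ^ (d * (a / d)) % ℓ     ≡⟨ cong (λ z → q ^ (a % d) * z % ℓ) (sym (^-*-assoc q d (a / d))) ⟩
      q ^ (a % d) * (q ^ d) ^ (a / d) % ℓ     ≡⟨ cong (_% ℓ) (*-comm (q ^ (a % d)) _) ⟩
      (q ^ d) ^ (a / d) * q ^ (a % d) % ℓ     ≡⟨ %≡1⇒*-% _ (q ^ (a % d)) (%≡1⇒^%≡1 (q ^ d) (a / d) 1<ℓ qᵈ≡1) ⟩
      q ^ (a % d) % ℓ ∎
    where open ≡-Reasoning

  -- The multiplicative order d of q modulo ℓ divides every a with q^a ≡ 1 (mod ℓ):
  -- the remainder r = a mod d satisfies q^r ≡ 1, so r = 0 by minimality of d.
  order-divides : ∀ {q ℓ d} .{{_ : NonZero ℓ}} → 1 < ℓ → 1 ≤ q → IsOrder q ℓ d →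
                  ∀ a → ℓ ∣ q ^ a ∸ 1 → d ∣ a
  order-divides {q} {ℓ} {d@(suc _)} 1<ℓ 1≤q (_ , ℓ∣qᵈ-1 , minimal) a ℓ∣qᵃ-1
    with a % d in a%d≡r | ^-reduce q d 1<ℓ (∣∸1⇒%≡1 _ 1<ℓ (m^n>0 q {{>-nonZero 1≤q}} d) ℓ∣qᵈ-1) a
  ... | zero  | _       = m%n≡0⇒n∣m a d a%d≡r
  ... | suc r | reduced = ⊥-elim (minimal (suc r) (s≤s z≤n) (subst (_< d) a%d≡r (m%n<n a d))
                            (%≡⇒∣∸ (q ^ suc r) 1 qʳ≡1))
    where
    qʳ≡1 : q ^ suc r % ℓ ≡ 1 % ℓ
    qʳ≡1 = trans (sym reduced) (trans (∣∸1⇒%≡1 _ 1<ℓ (m^n>0 q {{>-nonZero 1≤q}} a) ℓ∣qᵃ-1) (sym (m<n⇒m%n≡m 1<ℓ)))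

  -- For a prime ℓ ∤ q, the order of q modulo ℓ divides ℓ - 1 (Fermat).
  order∣ℓ-1 : ∀ {q n d} → Prime (suc n) → ¬ (suc n ∣ q) → 1 ≤ q → IsOrder q (suc n) d → d ∣ n
  order∣ℓ-1 {q} {n} pr ℓ∤q 1≤q ord = order-divides (prime≥2 pr) 1≤q ord n ℓ∣qⁿ-1
    where
    factor : q ^ suc n ∸ q ≡ q * (q ^ n ∸ 1)
    factor = trans (cong (q * q ^ n ∸_) (sym (*-identityʳ q))) (sym (*-distribˡ-∸ q (q ^ n) 1))
    ℓ∣qⁿ-1 : suc n ∣ q ^ n ∸ 1
    ℓ∣qⁿ-1 with euclidsLemma q (q ^ n ∸ 1) pr (subst (suc n ∣_) factor (%≡⇒∣∸ (q ^ suc n) q (fermat n pr q)))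
    ... | inj₁ ℓ∣q = ⊥-elim (ℓ∤q ℓ∣q)
    ... | inj₂ ℓ∣qⁿ-1 = ℓ∣qⁿ-1

  prime∣prime^⇒≡ : ∀ {ℓ p} → Prime ℓ → Prime p → ∀ m → ℓ ∣ p ^ m → ℓ ≡ p
  prime∣prime^⇒≡ prℓ prp zero    ℓ∣1 = ⊥-elim (<⇒≢ (prime≥2 prℓ) (sym (∣1⇒≡1 ℓ∣1)))
  prime∣prime^⇒≡ prℓ prp (suc m) ℓ∣pᵐ⁺¹ with euclidsLemma _ _ prℓ ℓ∣pᵐ⁺¹
  ... | inj₂ ℓ∣pᵐ = prime∣prime^⇒≡ prℓ prp m ℓ∣pᵐ
  ... | inj₁ ℓ∣p with prime⇒irreducible prp ℓ∣p
  ...   | inj₁ ℓ≡1 = ⊥-elim (<⇒≢ (prime≥2 prℓ) (sym ℓ≡1))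
  ...   | inj₂ ℓ≡p = ℓ≡p

  ∏-distinct-primes∣ : ∀ {N} (L : List ℕ) → Unique L → All Prime L → All (_∣ N) L → product L ∣ N
  ∏-distinct-primes∣ []      _           _           _           = 1∣ _
  ∏-distinct-primes∣ (x ∷ L) (x∉L ∷ uniq) (prx ∷ prL) (x∣N ∷ L∣N)
    with ∏-distinct-primes∣ L uniq prL L∣N
  ... | divides t N≡t*∏L = subst (x * product L ∣_) (sym N≡t*∏L) (*-pres-∣ x∣t (∣-refl {product L}))
    where
    coprime : Coprime x (product L)
    coprime (i∣x , i∣∏L) with prime⇒irreducible prx i∣x
    ... | inj₁ i≡1 = i≡1
    ... | inj₂ refl = ⊥-elim (All¬⇒¬Any x∉L (factorisationHasAllPrimeFactors prx i∣∏L prL))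
    x∣t : x ∣ t
    x∣t = coprime-divisor coprime (subst (x ∣_) (trans N≡t*∏L (*-comm t (product L))) x∣N)

  2^length≤∏ : (L : List ℕ) → All (2 ≤_) L → 2 ^ length L ≤ product L
  2^length≤∏ []      []         = ≤-refl
  2^length≤∏ (x ∷ L) (2≤x ∷ 2≤L) = *-mono-≤ 2≤x (2^length≤∏ L 2≤L)

  distinct-prime-divisors : ∀ {N} → 1 ≤ N → (L : List ℕ) → Unique L → All Prime L → All (_∣ N) L →
                            2 ^ length L ≤ N
  distinct-prime-divisors {suc _} _ L uniq prL L∣N =
    ≤-trans (2^length≤∏ L (All.map prime≥2 prL)) (∣⇒≤ (∏-distinct-primes∣ L uniq prL L∣N))

  2≤p^m : ∀ {p} m → Prime p → 1 ≤ m → 2 ≤ p ^ m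
  2≤p^m {p} (suc m) pr _ = ≤-trans (prime≥2 pr) (m≤m*n p (p ^ m) {{m^n≢0 p m {{prime⇒nonZero pr}}}})

module Logarithms where

  open import Data.Nat
  open import Data.Nat.Properties
  open import Data.Nat.Logarithm using (⌊log₂_⌋; ⌊log₂⌋-mono-≤; ⌊log₂[2^n]⌋≡n; ⌊log₂⌊n/2⌋⌋≡⌊log₂n⌋∸1)
  open import Data.Nat.Induction using (<-rec)
  open import Relation.Binary.PropositionalEquality
  open import Data.Nat.Solver using (module +-*-Solver)
  open +-*-Solver using (solve; _:+_; _:*_; _:=_; con)

  1≤⌊log₂⌋ : ∀ {d} → 2 ≤ d → 1 ≤ ⌊log₂ d ⌋
  1≤⌊log₂⌋ {d} 2≤d = subst (_≤ ⌊log₂ d ⌋) (⌊log₂[2^n]⌋≡n 1) (⌊log₂⌋-mono-≤ 2≤d)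

  -- Upper bracket  d < 2^(1 + ⌊log₂ d⌋), since ⌊log₂⌋ is monotone and exact on powers of 2.
  <2^suc⌊log₂⌋ : ∀ d → d < 2 ^ suc ⌊log₂ d ⌋
  <2^suc⌊log₂⌋ d = ≰⇒> (λ 2^ⁿ⁺¹≤d →
    1+n≰n (subst (_≤ ⌊log₂ d ⌋) (⌊log₂[2^n]⌋≡n _) (⌊log₂⌋-mono-≤ 2^ⁿ⁺¹≤d)))

  -- Lower bracket  2^⌊log₂ d⌋ ≤ d for d ≥ 1, by strong induction via ⌊log₂ d⌋ = 1 + ⌊log₂ ⌊d/2⌋⌋.
  2^⌊log₂⌋≤ : ∀ d → 1 ≤ d → 2 ^ ⌊log₂ d ⌋ ≤ d
  2^⌊log₂⌋≤ = <-rec (λ d → 1 ≤ d → 2 ^ ⌊log₂ d ⌋ ≤ d) halving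
    where
    halving : ∀ d → (∀ {e} → e < d → 1 ≤ e → 2 ^ ⌊log₂ e ⌋ ≤ e) → 1 ≤ d → 2 ^ ⌊log₂ d ⌋ ≤ d
    halving (suc zero)      _  _ = ≤-refl
    halving d@(suc (suc n)) ih _ = begin
        2 ^ ⌊log₂ d ⌋               ≡⟨ cong (2 ^_) (sym (m+[n∸m]≡n (1≤⌊log₂⌋ {d} (s≤s (s≤s z≤n))))) ⟩
        2 * 2 ^ (⌊log₂ d ⌋ ∸ 1)     ≡⟨ cong (λ e → 2 * 2 ^ e) (sym (⌊log₂⌊n/2⌋⌋≡⌊log₂n⌋∸1 d)) ⟩
        2 * 2 ^ ⌊log₂ half ⌋        ≤⟨ *-monoʳ-≤ 2 (ih (⌊n/2⌋<n (suc n)) (⌊n/2⌋-mono {2} (s≤s (s≤s z≤n)))) ⟩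
        2 * half                    ≡⟨ cong (half +_) (+-identityʳ half) ⟩
        half + half                 ≤⟨ +-monoʳ-≤ half (⌊n/2⌋≤⌈n/2⌉ d) ⟩
        half + ⌈ d /2⌉              ≡⟨ ⌊n/2⌋+⌈n/2⌉≡n d ⟩
        d ∎
      where
      open ≤-Reasoning
      half : ℕ
      half = ⌊ d /2⌋

  n<2^n : ∀ n → n < 2 ^ n
  n<2^n zero    = s≤s z≤n
  n<2^n (suc n) = subst (_≤ 2 ^ suc n) (+-comm (suc n) 1)
    (subst (suc n + 1 ≤_) (cong (2 ^ n +_) (sym (+-identityʳ (2 ^ n)))) (+-mono-≤ (n<2^n n) (m^n>0 2 n)))

  -- n(n+1) ≤ 2^(n+1): the quadratic-versus-exponential bound behind log d / d → 0.
  n*[1+n]≤2^[1+n] : ∀ n → n * suc n ≤ 2 ^ suc n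
  n*[1+n]≤2^[1+n] zero    = z≤n
  n*[1+n]≤2^[1+n] (suc n) = begin
      suc n * suc (suc n)
        ≡⟨ solve 1 (λ n → (con 1 :+ n) :* (con 2 :+ n) := n :* (con 1 :+ n) :+ con 2 :* (con 1 :+ n)) refl n ⟩
      n * suc n + 2 * suc n
        ≤⟨ +-mono-≤ (n*[1+n]≤2^[1+n] n) (*-monoʳ-≤ 2 (n<2^n n)) ⟩
      2 * 2 ^ n + 2 * 2 ^ n
        ≡⟨ solve 1 (λ t → con 2 :* t :+ con 2 :* t := con 2 :* (con 2 :* t)) refl (2 ^ n) ⟩
      2 ^ suc (suc n) ∎
    where open ≤-Reasoning

  k*⌊log₂⌋≤ : ∀ {k d} → 1 ≤ d → 2 * k ≤ ⌊log₂ d ⌋ → k * ⌊log₂ d ⌋ ≤ d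
  k*⌊log₂⌋≤ {k} {d} 1≤d 2k≤n = *-cancelˡ-≤ 2 (begin
      2 * (k * n)        ≡⟨ sym (*-assoc 2 k n) ⟩
      2 * k * n          ≤⟨ *-monoˡ-≤ n 2k≤n ⟩
      n * n              ≤⟨ *-monoʳ-≤ n (n≤1+n n) ⟩
      n * suc n          ≤⟨ n*[1+n]≤2^[1+n] n ⟩
      2 * 2 ^ n          ≤⟨ *-monoʳ-≤ 2 (2^⌊log₂⌋≤ d 1≤d) ⟩
      2 * d ∎)
    where
    open ≤-Reasoning
    n : ℕ
    n = ⌊log₂ d ⌋

  a+1+n≤[2+a]*n : ∀ a {n} → 1 ≤ n → a + suc n ≤ suc (suc a) * n
  a+1+n≤[2+a]*n a {suc n} _ = begin
      a + suc (suc n)        ≡⟨ trans (+-suc a (suc n)) (cong suc (+-suc a n)) ⟩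
      suc (suc a) + n        ≤⟨ +-monoʳ-≤ (suc (suc a)) (m≤n*m n (suc (suc a))) ⟩
      suc (suc a) + suc (suc a) * n   ≡⟨ sym (*-suc (suc (suc a)) n) ⟩
      suc (suc a) * suc n ∎
    where open ≤-Reasoning

module RationalEstimates where

  open import Defs using (inv; sumInv; prodG)
  open import Data.Nat as ℕ using (ℕ; zero; suc)
  import Data.Nat.Properties as ℕ
  open import Data.Nat.Solver renaming (module +-*-Solver to ℕ-Solver)
  open import Data.Integer as ℤ using (+_)
  import Data.Integer.Properties as ℤ
  open import Data.Rational as ℚ using (ℚ; _/_; _+_; _*_; _-_; 0ℚ; 1ℚ; _≤_; _<_; toℚᵘ)
  import Data.Rational.Properties as ℚ
  open import Data.Rational.Unnormalised as ℚᵘ using (mkℚᵘ; *≡*; *≤*; *<*)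
  import Data.Rational.Unnormalised.Properties as ℚᵘ
  open import Data.Rational.Solver renaming (module +-*-Solver to ℚ-Solver)
  open import Data.List using (List; []; _∷_; length)
  open import Data.List.Membership.Propositional using (_∈_)
  open import Data.List.Membership.DecPropositional ℕ._≟_ using (_∈?_)
  open import Data.List.Relation.Unary.Any using (here; there)
  open import Data.List.Relation.Unary.All as All using (All; _∷_)
  open import Data.List.Relation.Unary.All.Properties using (All¬⇒¬Any)
  open import Data.List.Relation.Unary.Unique.Propositional using (Unique)
  open import Data.List.Relation.Unary.AllPairs using (_∷_)
  open import Data.Product using (_×_; _,_; ∃-syntax)
  open import Data.Sum using (inj₁; inj₂)
  open import Data.Empty using (⊥-elim)
  open import Relation.Nullary using (¬_; yes; no)
  open import Relation.Binary.PropositionalEquality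

  -- Fractions a/(1+b) are compared and combined by cross-multiplication in ℕ,
  -- through the unnormalised representation  a/(1+b) ≃ mkℚᵘ a b.

  private
    toℚᵘ-frac : ∀ a b → toℚᵘ (+ a / suc b) ℚᵘ.≃ mkℚᵘ (+ a) b
    toℚᵘ-frac a b = ℚ.toℚᵘ-fromℚᵘ (mkℚᵘ (+ a) b)

  frac-≤ : ∀ a b c d → a ℕ.* suc d ℕ.≤ c ℕ.* suc b → + a / suc b ≤ + c / suc d
  frac-≤ a b c d h = ℚ.toℚᵘ-cancel-≤
    (ℚᵘ.≤-respˡ-≃ (ℚᵘ.≃-sym (toℚᵘ-frac a b)) (ℚᵘ.≤-respʳ-≃ (ℚᵘ.≃-sym (toℚᵘ-frac c d))
      (*≤* (subst₂ ℤ._≤_ (ℤ.pos-* a (suc d)) (ℤ.pos-* c (suc b)) (ℤ.+≤+ h)))))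

  frac-< : ∀ a b c d → a ℕ.* suc d ℕ.< c ℕ.* suc b → + a / suc b < + c / suc d
  frac-< a b c d h = ℚ.toℚᵘ-cancel-<
    (ℚᵘ.<-respˡ-≃ (ℚᵘ.≃-sym (toℚᵘ-frac a b)) (ℚᵘ.<-respʳ-≃ (ℚᵘ.≃-sym (toℚᵘ-frac c d))
      (*<* (subst₂ ℤ._<_ (ℤ.pos-* a (suc d)) (ℤ.pos-* c (suc b)) (ℤ.+<+ h)))))

  frac-≡ : ∀ a b c d → a ℕ.* suc d ≡ c ℕ.* suc b → + a / suc b ≡ + c / suc d
  frac-≡ a b c d e = ℚ.≤-antisym (frac-≤ a b c d (ℕ.≤-reflexive e)) (frac-≤ c d a b (ℕ.≤-reflexive (sym e)))

  frac-* : ∀ a b c d → (+ a / suc b) * (+ c / suc d) ≡ + (a ℕ.* c) / (suc b ℕ.* suc d)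
  frac-* a b c d = ℚ.toℚᵘ-injective (ℚᵘ.≃-trans (ℚ.toℚᵘ-homo-* (+ a / suc b) (+ c / suc d))
    (ℚᵘ.≃-trans (ℚᵘ.*-cong (toℚᵘ-frac a b) (toℚᵘ-frac c d))
    (ℚᵘ.≃-trans (*≡* (cong (ℤ._* (+ (suc b ℕ.* suc d))) (sym (ℤ.pos-* a c))))
    (ℚᵘ.≃-sym (toℚᵘ-frac (a ℕ.* c) _)))))

  frac-+ : ∀ a b c d → (+ a / suc b) + (+ c / suc d) ≡ + (a ℕ.* suc d ℕ.+ c ℕ.* suc b) / (suc b ℕ.* suc d)
  frac-+ a b c d = ℚ.toℚᵘ-injective (ℚᵘ.≃-trans (ℚ.toℚᵘ-homo-+ (+ a / suc b) (+ c / suc d))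
    (ℚᵘ.≃-trans (ℚᵘ.+-cong (toℚᵘ-frac a b) (toℚᵘ-frac c d))
    (ℚᵘ.≃-trans (*≡* (cong (ℤ._* (+ (suc b ℕ.* suc d)))
       (trans (cong₂ ℤ._+_ (sym (ℤ.pos-* a (suc d))) (sym (ℤ.pos-* c (suc b))))
              (sym (ℤ.pos-+ (a ℕ.* suc d) (c ℕ.* suc b))))))
    (ℚᵘ.≃-sym (toℚᵘ-frac (a ℕ.* suc d ℕ.+ c ℕ.* suc b) _)))))

  *-monoˡ-≤-nonneg : ∀ {r p q} → 0ℚ ≤ r → p ≤ q → r * p ≤ r * q
  *-monoˡ-≤-nonneg {r} 0≤r = ℚ.*-monoˡ-≤-nonNeg r {{ℚ.nonNegative 0≤r}}

  *-nonneg : ∀ {p q} → 0ℚ ≤ p → 0ℚ ≤ q → 0ℚ ≤ p * q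
  *-nonneg {p} {q} 0≤p 0≤q = subst (_≤ p * q) (ℚ.*-zeroʳ p) (*-monoˡ-≤-nonneg 0≤p 0≤q)

  +-nonneg : ∀ {p q} → 0ℚ ≤ p → 0ℚ ≤ q → 0ℚ ≤ p + q
  +-nonneg = ℚ.+-mono-≤

  p≤q⇒0≤q-p : ∀ {p q} → p ≤ q → 0ℚ ≤ q - p
  p≤q⇒0≤q-p {p} {q} p≤q = subst (_≤ q - p) (ℚ.+-inverseʳ p) (ℚ.+-monoˡ-≤ (ℚ.- p) p≤q)

  inv-nonneg : ∀ n → 0ℚ ≤ inv n
  inv-nonneg zero    = ℚ.≤-refl
  inv-nonneg (suc n) = frac-≤ 0 0 1 n ℕ.z≤n

  inv≤1 : ∀ n → inv n ≤ 1ℚ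
  inv≤1 zero    = frac-≤ 0 0 1 0 ℕ.z≤n
  inv≤1 (suc n) = frac-≤ 1 n 1 0 (ℕ.s≤s ℕ.z≤n)

  inv-antitone : ∀ {a b} → 1 ℕ.≤ a → a ℕ.≤ b → inv b ≤ inv a
  inv-antitone {suc a} {suc b} _ a≤b = frac-≤ 1 b 1 a (ℕ.*-monoʳ-≤ 1 a≤b)

  weierstrass : (L : List ℕ) → (0ℚ ≤ prodG L) × (prodG L ≤ 1ℚ) × (1ℚ - prodG L ≤ sumInv L)
  weierstrass []      = frac-≤ 0 0 1 0 ℕ.z≤n , ℚ.≤-refl , ℚ.≤-reflexive (ℚ.+-inverseʳ 1ℚ)
  weierstrass (x ∷ L) with weierstrass L
  ... | 0≤P , P≤1 , 1-P≤Σ = *-nonneg 0≤1-i 0≤P , factor≤1 , deficit≤sum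
    where
    open ℚ.≤-Reasoning
    open ℚ-Solver
    i : ℚ
    i = inv x
    P : ℚ
    P = prodG L
    0≤1-i : 0ℚ ≤ 1ℚ - i
    0≤1-i = p≤q⇒0≤q-p (inv≤1 x)
    factor≤1 : (1ℚ - i) * P ≤ 1ℚ
    factor≤1 = begin
      (1ℚ - i) * P   ≤⟨ ℚ.*-monoʳ-≤-nonNeg P {{ℚ.nonNegative 0≤P}} (ℚ.+-monoʳ-≤ 1ℚ (ℚ.neg-antimono-≤ (inv-nonneg x))) ⟩
      1ℚ * P         ≡⟨ ℚ.*-identityˡ P ⟩
      P              ≤⟨ P≤1 ⟩
      1ℚ ∎
    deficit≤sum : 1ℚ - (1ℚ - i) * P ≤ i + sumInv L
    deficit≤sum = begin
      1ℚ - (1ℚ - i) * P  ≡⟨ solve 2 (λ i P → con 1ℚ :- (con 1ℚ :- i) :* P := (con 1ℚ :- P) :+ i :* P) refl i P ⟩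
      (1ℚ - P) + i * P   ≤⟨ ℚ.+-mono-≤ 1-P≤Σ (*-monoˡ-≤-nonneg (inv-nonneg x) P≤1) ⟩
      sumInv L + i * 1ℚ  ≡⟨ solve 2 (λ s i → s :+ i :* con 1ℚ := i :+ s) refl (sumInv L) i ⟩
      i + sumInv L ∎

  H : ℕ → ℕ → ℚ
  H a zero    = 0ℚ
  H a (suc k) = inv a + H (suc a) k

  H-nonneg : ∀ a k → 0ℚ ≤ H a k
  H-nonneg a zero    = ℚ.≤-refl
  H-nonneg a (suc k) = +-nonneg (inv-nonneg a) (H-nonneg (suc a) k)

  H-split : ∀ a k₁ k₂ → H a (k₁ ℕ.+ k₂) ≡ H a k₁ + H (k₁ ℕ.+ a) k₂
  H-split a zero     k₂ = sym (ℚ.+-identityˡ (H a k₂))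
  H-split a (suc k₁) k₂ = begin
      inv a + H (suc a) (k₁ ℕ.+ k₂)                   ≡⟨ cong (λ z → inv a + z) (H-split (suc a) k₁ k₂) ⟩
      inv a + (H (suc a) k₁ + H (k₁ ℕ.+ suc a) k₂)    ≡⟨ sym (ℚ.+-assoc (inv a) _ _) ⟩
      (inv a + H (suc a) k₁) + H (k₁ ℕ.+ suc a) k₂    ≡⟨ cong (λ z → (inv a + H (suc a) k₁) + H z k₂) (ℕ.+-suc k₁ a) ⟩
      (inv a + H (suc a) k₁) + H (suc k₁ ℕ.+ a) k₂ ∎
    where open ≡-Reasoning

  -- Each of the k terms of H (1+a) k is at most 1/(1+a).
  H≤k/[1+a] : ∀ a k → H (suc a) k ≤ + k / suc a
  H≤k/[1+a] a zero    = frac-≤ 0 0 0 a ℕ.z≤n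
  H≤k/[1+a] a (suc k) = begin
      inv (suc a) + H (suc (suc a)) k
        ≤⟨ ℚ.+-monoʳ-≤ (inv (suc a)) (ℚ.≤-trans (H≤k/[1+a] (suc a) k)
                                                (frac-≤ k (suc a) k a (ℕ.*-monoʳ-≤ k (ℕ.n≤1+n (suc a))))) ⟩
      + 1 / suc a + + k / suc a
        ≡⟨ frac-+ 1 a k a ⟩
      + (1 ℕ.* suc a ℕ.+ k ℕ.* suc a) / (suc a ℕ.* suc a)
        ≡⟨ frac-≡ (1 ℕ.* suc a ℕ.+ k ℕ.* suc a) (a ℕ.+ a ℕ.* suc a) (suc k) a (solve 2 (λ a k →
             (con 1 :* (con 1 :+ a) :+ k :* (con 1 :+ a)) :* (con 1 :+ a)
             := (con 1 :+ k) :* ((con 1 :+ a) :* (con 1 :+ a))) refl a k) ⟩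
      + suc k / suc a ∎
    where
    open ℚ.≤-Reasoning
    open ℕ-Solver

  H-shift : ∀ a k → 1 ℕ.≤ a → H (suc a) k ≤ H a k
  H-shift a zero    _   = ℚ.≤-refl
  H-shift a (suc k) 1≤a = ℚ.+-mono-≤ (inv-antitone 1≤a (ℕ.n≤1+n a)) (H-shift (suc a) k (ℕ.m≤n⇒m≤1+n 1≤a))

  H-mono : ∀ a {k k′} → k ℕ.≤ k′ → H a k ≤ H a k′
  H-mono a {zero}  {k′}     _           = H-nonneg a k′
  H-mono a {suc k} {suc k′} (ℕ.s≤s k≤k′) = ℚ.+-monoʳ-≤ (inv a) (H-mono (suc a) k≤k′)

  -- Dyadic blocks: H 1 (2^N - 1) ≤ N, since each block [2^n, 2^(n+1)) contributes at most 1.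
  H-dyadic : ∀ N → H 1 (2 ℕ.^ N ℕ.∸ 1) ≤ + N / 1
  H-dyadic zero    = ℚ.≤-refl
  H-dyadic (suc N) = begin
      H 1 (2 ℕ.^ suc N ℕ.∸ 1)     ≡⟨ cong (H 1) doubling ⟩
      H 1 (t ℕ.+ suc t)           ≡⟨ H-split 1 t (suc t) ⟩
      H 1 t + H (t ℕ.+ 1) (suc t) ≡⟨ cong (λ z → H 1 t + H z (suc t)) (ℕ.+-comm t 1) ⟩
      H 1 t + H (suc t) (suc t)   ≤⟨ ℚ.+-mono-≤ (H-dyadic N) (ℚ.≤-trans (H≤k/[1+a] t (suc t))
                                                                      (frac-≤ (suc t) t 1 0 (ℕ.≤-reflexive (ℕ.*-comm (suc t) 1)))) ⟩
      + N / 1 + + 1 / 1           ≡⟨ frac-+ N 0 1 0 ⟩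
      + (N ℕ.* 1 ℕ.+ 1) / 1       ≡⟨ cong (λ n → + (n ℕ.+ 1) / 1) (ℕ.*-identityʳ N) ⟩
      + (N ℕ.+ 1) / 1             ≡⟨ cong (λ n → + n / 1) (ℕ.+-comm N 1) ⟩
      + suc N / 1 ∎
    where
    open ℚ.≤-Reasoning
    t : ℕ
    t = 2 ℕ.^ N ℕ.∸ 1
    doubling : 2 ℕ.^ suc N ℕ.∸ 1 ≡ t ℕ.+ suc t
    doubling = trans (cong (λ s → s ℕ.+ (s ℕ.+ 0) ℕ.∸ 1) (sym (ℕ.m+[n∸m]≡n (ℕ.m^n>0 2 N))))
                     (cong (t ℕ.+_) (ℕ.+-identityʳ (suc t)))

  H-≤-exponent : ∀ {k} N → k ℕ.< 2 ℕ.^ N → H 1 k ≤ + N / 1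
  H-≤-exponent N k<2ᴺ = ℚ.≤-trans (H-mono 1 (ℕ.∸-monoˡ-≤ 1 k<2ᴺ)) (H-dyadic N)

  record Removal (y : ℕ) (S : List ℕ) : Set where
    field
      rest     : List ℕ
      unique   : Unique rest
      length≡  : length S ≡ suc (length rest)
      sumInv≡  : sumInv S ≡ inv y + sumInv rest
      ⊆S       : ∀ {x} → x ∈ rest → x ∈ S
      ≢y       : ∀ {x} → x ∈ rest → ¬ x ≡ y

  remove : ∀ {y} (S : List ℕ) → y ∈ S → Unique S → Removal y S
  remove (y ∷ S) (here refl) (y∉S ∷ uniq) = record
    { rest = S ; unique = uniq ; length≡ = refl ; sumInv≡ = refl
    ; ⊆S = there ; ≢y = λ x∈S x≡y → All¬⇒¬Any y∉S (subst (_∈ S) x≡y x∈S) }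
  remove {y} (z ∷ S) (there y∈S) (z∉S ∷ uniq) = record
    { rest = z ∷ R.rest ; unique = z∉rest ∷ R.unique ; length≡ = cong suc R.length≡
    ; sumInv≡ = sum≡ ; ⊆S = ⊆S ; ≢y = ≢y }
    where
    open ℚ-Solver
    module R = Removal (remove S y∈S uniq)
    z∉rest : All (λ x → ¬ z ≡ x) R.rest
    z∉rest = All.tabulate (λ x∈rest → All.lookup z∉S (R.⊆S x∈rest))
    sum≡ : inv z + sumInv S ≡ inv y + (inv z + sumInv R.rest)
    sum≡ = trans (cong (λ s → inv z + s) R.sumInv≡)
                 (solve 3 (λ a b c → a :+ (b :+ c) := b :+ (a :+ c)) refl (inv z) (inv y) (sumInv R.rest))
    ⊆S : ∀ {x} → x ∈ z ∷ R.rest → x ∈ z ∷ S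
    ⊆S (here x≡z)      = here x≡z
    ⊆S (there x∈rest)  = there (R.⊆S x∈rest)
    ≢y : ∀ {x} → x ∈ z ∷ R.rest → ¬ x ≡ y
    ≢y (here refl)     = λ z≡y → All.lookup z∉S y∈S z≡y
    ≢y (there x∈rest)  = R.≢y x∈rest

  InProgression : ℕ → ℕ → ℕ → ℕ → Set
  InProgression d a n x = ∃[ j ] (x ≡ suc (d ℕ.* j) × a ℕ.≤ j × j ℕ.< a ℕ.+ n)

  shrink-window : ∀ {d a n x} → InProgression d a (suc n) x → ¬ x ≡ suc (d ℕ.* a) → InProgression d (suc a) n x
  shrink-window (j , x≡ , a≤j , j<) x≢ with ℕ.m≤n⇒m<n∨m≡n a≤j
  ... | inj₁ a<j  = j , x≡ , a<j , subst (j ℕ.<_) (ℕ.+-suc _ _) j<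
  ... | inj₂ refl = ⊥-elim (x≢ x≡)

  1/[1+dj]≤1/d·1/j : ∀ d j → 1 ℕ.≤ d → 1 ℕ.≤ j → inv (suc (d ℕ.* j)) ≤ inv d * inv j
  1/[1+dj]≤1/d·1/j (suc d) (suc j) _ _ = subst (inv (suc (suc d ℕ.* suc j)) ≤_) (sym (frac-* 1 d 1 j))
    (frac-≤ 1 (suc d ℕ.* suc j) 1 (j ℕ.+ d ℕ.* suc j) (ℕ.*-monoʳ-≤ 1 (ℕ.n≤1+n _)))

  -- Induction on the width n of the index window:
  -- the smallest admissible index a is used at most once, costing at most 1/(da).
  progression-sum : ∀ d → 1 ℕ.≤ d → ∀ n a → 1 ℕ.≤ a → (S : List ℕ) → Unique S →
                    (∀ {x} → x ∈ S → InProgression d a n x) → sumInv S ≤ inv d * H a (length S)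
  progression-sum d 1≤d zero a 1≤a []      _ _ = ℚ.≤-reflexive (sym (ℚ.*-zeroʳ (inv d)))
  progression-sum d 1≤d zero a 1≤a (x ∷ S) _ inS with inS (here refl)
  ... | j , _ , a≤j , j<a+0 = ⊥-elim (ℕ.<⇒≱ (subst (j ℕ.<_) (ℕ.+-identityʳ a) j<a+0) a≤j)
  progression-sum d 1≤d (suc n) a 1≤a S uniq inS with suc (d ℕ.* a) ∈? S
  ... | yes y∈S = begin
      sumInv S                                      ≡⟨ R.sumInv≡ ⟩
      inv y + sumInv R.rest                         ≤⟨ ℚ.+-mono-≤ (1/[1+dj]≤1/d·1/j d a 1≤d 1≤a)
                                                         (progression-sum d 1≤d n (suc a) (ℕ.m≤n⇒m≤1+n 1≤a) R.rest R.unique inRest) ⟩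
      inv d * inv a + inv d * H (suc a) (length R.rest) ≡⟨ sym (ℚ.*-distribˡ-+ (inv d) (inv a) _) ⟩
      inv d * H a (suc (length R.rest))             ≡⟨ cong (λ k → inv d * H a k) (sym R.length≡) ⟩
      inv d * H a (length S) ∎
    where
    open ℚ.≤-Reasoning
    y : ℕ
    y = suc (d ℕ.* a)
    module R = Removal (remove S y∈S uniq)
    inRest : ∀ {x} → x ∈ R.rest → InProgression d (suc a) n x
    inRest x∈rest = shrink-window {d} (inS (R.⊆S x∈rest)) (R.≢y x∈rest)
  ... | no y∉S = ℚ.≤-trans (progression-sum d 1≤d n (suc a) (ℕ.m≤n⇒m≤1+n 1≤a) S uniq inS′)
                           (*-monoˡ-≤-nonneg (inv-nonneg d) (H-shift a (length S) 1≤a))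
    where
    inS′ : ∀ {x} → x ∈ S → InProgression d (suc a) n x
    inS′ x∈S = shrink-window {d} (inS x∈S) (λ x≡y → y∉S (subst (_∈ S) x≡y x∈S))

  inv-telescope : ∀ n → inv (suc n) ≡ inv (suc (suc n)) + inv (suc n) * inv (suc (suc n))
  inv-telescope n = begin
      + 1 / suc n
        ≡⟨ frac-≡ 1 n (1 ℕ.* suc P ℕ.+ 1 ℕ.* suc (suc n)) (P ℕ.+ suc n ℕ.* suc P) (solve 1 (λ n →
             let P = (con 1 :+ n) :+ n :* (con 2 :+ n) in
             con 1 :* (con 1 :+ (P :+ (con 1 :+ n) :* (con 1 :+ P)))
             := (con 1 :* (con 1 :+ P) :+ con 1 :* (con 2 :+ n)) :* (con 1 :+ n))
             refl n) ⟩
      + (1 ℕ.* suc P ℕ.+ 1 ℕ.* suc (suc n)) / (suc (suc n) ℕ.* suc P)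
        ≡⟨ sym (frac-+ 1 (suc n) 1 P) ⟩
      + 1 / suc (suc n) + + 1 / (suc n ℕ.* suc (suc n))
        ≡⟨ cong (λ z → + 1 / suc (suc n) + z) (sym (frac-* 1 n 1 (suc n))) ⟩
      + 1 / suc (suc n) + (+ 1 / suc n) * (+ 1 / suc (suc n)) ∎
    where
    open ≡-Reasoning
    open ℕ-Solver
    P : ℕ
    P = suc n ℕ.+ n ℕ.* suc (suc n)

  inv≤2·inv-next : ∀ n → inv (suc n) ≤ inv (suc (suc n)) + inv (suc (suc n))
  inv≤2·inv-next n = begin
      + 1 / suc n
        ≤⟨ frac-≤ 1 n 2 (suc n) (ℕ.s≤s (ℕ.m≤n+m (suc (n ℕ.+ 0)) n)) ⟩
      + 2 / suc (suc n)
        ≡⟨ frac-≡ 2 (suc n) (1 ℕ.* suc (suc n) ℕ.+ 1 ℕ.* suc (suc n)) (suc n ℕ.+ suc n ℕ.* suc (suc n))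
             (solve 1 (λ n → con 2 :* (con 1 :+ ((con 1 :+ n) :+ (con 1 :+ n) :* (con 2 :+ n)))
                           := (con 1 :* (con 2 :+ n) :+ con 1 :* (con 2 :+ n)) :* (con 2 :+ n)) refl n) ⟩
      + (1 ℕ.* suc (suc n) ℕ.+ 1 ℕ.* suc (suc n)) / (suc (suc n) ℕ.* suc (suc n))
        ≡⟨ sym (frac-+ 1 (suc n) 1 (suc n)) ⟩
      + 1 / suc (suc n) + + 1 / suc (suc n) ∎
    where
    open ℚ.≤-Reasoning
    open ℕ-Solver

  -- The rational 2, written so that the ring solver sees it as 1 + 1.
  two : ℚ
  two = 1ℚ + 1ℚ

  two-nonneg : 0ℚ ≤ two
  two-nonneg = frac-≤ 0 0 2 0 ℕ.z≤n

  -- Algebraic core of the telescoping bound for Σ (1-g)/d.  For i = 1/d and j = 1/(d+1)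
  -- (so i = j + ij and i ≤ 2j) and X′ ≤ X + i, the potential 2i(X+2) pays for i²X:
  --   i²X + 2j(X′+2) ≤ 2i(X+2).
  potential-step : ∀ i j X X′ → 0ℚ ≤ i → 0ℚ ≤ j → 0ℚ ≤ X → X′ ≤ X + i → i ≡ j + i * j → i ≤ j + j →
                   i * (i * X) + two * (j * (X′ + two)) ≤ two * (i * (X + two))
  potential-step i j X X′ 0≤i 0≤j 0≤X X′≤X+i i≡j+ij i≤2j = begin
      i * (i * X) + two * (j * (X′ + two))
        ≤⟨ ℚ.+-monoʳ-≤ (i * (i * X)) (*-monoˡ-≤-nonneg two-nonneg (*-monoˡ-≤-nonneg 0≤j (ℚ.+-monoˡ-≤ two X′≤X+i))) ⟩
      Lhs
        ≤⟨ ℚ.≤-trans (ℚ.≤-reflexive (sym (ℚ.+-identityʳ Lhs))) (ℚ.+-monoʳ-≤ Lhs 0≤slack) ⟩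
      Lhs + slack
        ≡⟨ solve 3 (λ i j X → let two = con 1ℚ :+ con 1ℚ in
             (i :* (i :* X) :+ two :* (j :* ((X :+ i) :+ two))) :+ (two :* (i :* j) :+ (X :* i) :* ((j :+ j) :- i))
             := two :* (i :* (X :+ two)) :+ (two :* X :+ two :* two) :* ((j :+ i :* j) :- i)) refl i j X ⟩
      two * (i * (X + two)) + (two * X + two * two) * ((j + i * j) - i)
        ≡⟨ cong (λ z → two * (i * (X + two)) + (two * X + two * two) * z) j+ij-i≡0 ⟩
      two * (i * (X + two)) + (two * X + two * two) * 0ℚ
        ≡⟨ trans (cong (λ z → two * (i * (X + two)) + z) (ℚ.*-zeroʳ (two * X + two * two))) (ℚ.+-identityʳ _) ⟩
      two * (i * (X + two)) ∎
    where
    open ℚ.≤-Reasoning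
    open ℚ-Solver
    Lhs : ℚ
    Lhs = i * (i * X) + two * (j * ((X + i) + two))
    slack : ℚ
    slack = two * (i * j) + (X * i) * ((j + j) - i)
    0≤slack : 0ℚ ≤ slack
    0≤slack = +-nonneg (*-nonneg two-nonneg (*-nonneg 0≤i 0≤j)) (*-nonneg (*-nonneg 0≤X 0≤i) (p≤q⇒0≤q-p i≤2j))
    j+ij-i≡0 : (j + i * j) - i ≡ 0ℚ
    j+ij-i≡0 = trans (cong (_- i) (sym i≡j+ij)) (ℚ.+-inverseʳ i)

module Bounds where

  open import Defs
  open NumberTheory using (prime≥2; order∣ℓ-1; prime∣prime^⇒≡; distinct-prime-divisors; 2≤p^m)
  open Logarithms using (<2^suc⌊log₂⌋; 1≤⌊log₂⌋; n<2^n; k*⌊log₂⌋≤; a+1+n≤[2+a]*n)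
  open RationalEstimates
  open import Data.Nat as ℕ using (ℕ; zero; suc; _^_)
  import Data.Nat.Properties as ℕ
  open import Data.Nat.Divisibility using (_∣_; divides; ∣⇒≤)
  open import Data.Nat.Primality using (Prime)
  open import Data.Nat.Logarithm using (⌊log₂_⌋; ⌊log₂⌋-mono-≤; ⌊log₂[2^n]⌋≡n)
  open import Data.Integer as ℤ using (+_)
  open import Data.Rational as ℚ using (ℚ; _/_; _+_; _*_; _-_; 0ℚ; 1ℚ; _≤_; _<_)
  import Data.Rational.Properties as ℚ
  open import Data.Rational.Solver renaming (module +-*-Solver to ℚ-Solver)
  open import Data.List using (List; length)
  open import Data.List.Membership.Propositional using (_∈_)
  open import Data.List.Relation.Unary.All as All using (All)
  open import Data.Product using (_×_; _,_; proj₁; proj₂; ∃-syntax)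
  open import Data.Empty using (⊥-elim)
  open import Function.Bundles using (Equivalence)
  open import Relation.Nullary using (¬_)
  open import Relation.Binary.PropositionalEquality

  module ForPrimePower (p m : ℕ) (prp : Prime p) (1≤m : 1 ℕ.≤ m) where

    q : ℕ
    q = p ^ m

    2≤q : 2 ℕ.≤ q
    2≤q = 2≤p^m m prp 1≤m

    1≤q : 1 ℕ.≤ q
    1≤q = ℕ.≤-trans (ℕ.n≤1+n 1) 2≤q

    -- q^d - 1 ≥ 1 for d ≥ 1: the primes of order d are divisors of this number.
    1≤qᵈ-1 : ∀ d → 1 ℕ.≤ d → 1 ℕ.≤ q ^ d ℕ.∸ 1
    1≤qᵈ-1 d 1≤d = ℕ.∸-monoˡ-≤ 1 (begin
        2       ≤⟨ 2≤q ⟩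
        q       ≡⟨ sym (ℕ.*-identityʳ q) ⟩
        q ^ 1   ≤⟨ ℕ.^-monoʳ-≤ q {{ℕ.>-nonZero 1≤q}} 1≤d ⟩
        q ^ d   ∎)
      where open ℕ.≤-Reasoning

    ≢p⇒∤q : ∀ {ℓ} → Prime ℓ → ¬ ℓ ≡ p → ¬ ℓ ∣ q
    ≢p⇒∤q prℓ ℓ≢p ℓ∣q = ℓ≢p (prime∣prime^⇒≡ prℓ prp m ℓ∣q)

    order-progression : ∀ {ℓ d} → Prime ℓ → ¬ ℓ ≡ p → IsOrder q ℓ d → ∃[ j ] (ℓ ≡ suc (d ℕ.* j) × 1 ℕ.≤ j)
    order-progression {zero} prℓ = ⊥-elim (ℕ.<⇒≱ (prime≥2 prℓ) ℕ.z≤n)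
    order-progression {suc n} {d} prℓ ℓ≢p ord
      with order∣ℓ-1 prℓ (≢p⇒∤q prℓ ℓ≢p) 1≤q ord
    ... | divides zero    n≡0     = ⊥-elim (ℕ.<⇒≱ (prime≥2 prℓ) (ℕ.≤-reflexive (cong suc n≡0)))
    ... | divides (suc j) n≡j*d = suc j , cong suc (trans n≡j*d (ℕ.*-comm (suc j) d)) , ℕ.s≤s ℕ.z≤n

    -- The majorant of d · Σ_{e_q(ℓ)=d} 1/ℓ: the harmonic number H_{qd}.
    X : ℕ → ℚ
    X d = H 1 (q ℕ.* d)

    -- An enumeration L of the primes ℓ ≠ p with e_q(ℓ) = d: its members are distinct primes
    -- dividing W = q^d - 1 and lying in 1 + dℕ, so |L| < qd and Σ 1/ℓ ≤ X d / d.
    module IndexSet (d : ℕ) (1≤d : 1 ℕ.≤ d) (L : List ℕ) (en : Enumerates (InG p q d) L) where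

      W : ℕ
      W = q ^ d ℕ.∸ 1

      member : ∀ {ℓ} → ℓ ∈ L → InG p q d ℓ
      member ℓ∈L = Equivalence.to (proj₂ en _) ℓ∈L

      all-prime : All Prime L
      all-prime = All.tabulate (λ ℓ∈L → proj₁ (member ℓ∈L))

      all-divide : All (_∣ W) L
      all-divide = All.tabulate (λ ℓ∈L → proj₁ (proj₂ (proj₂ (proj₂ (member ℓ∈L)))))

      in-progression : ∀ {ℓ} → ℓ ∈ L → InProgression d 1 W ℓ
      in-progression {ℓ} ℓ∈L with member ℓ∈L
      ... | prℓ , ℓ≢p , ord with order-progression prℓ ℓ≢p ord
      ...   | j , ℓ≡1+dj , 1≤j = j , ℓ≡1+dj , 1≤j , ℕ.<-≤-trans j<ℓ (ℕ.m≤n⇒m≤1+n ℓ≤W)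
        where
        j<ℓ : j ℕ.< ℓ
        j<ℓ = subst (j ℕ.<_) (sym ℓ≡1+dj) (ℕ.s≤s (ℕ.m≤n*m j d {{ℕ.>-nonZero 1≤d}}))
        ℓ≤W : ℓ ℕ.≤ W
        ℓ≤W = ∣⇒≤ {{ℕ.>-nonZero (1≤qᵈ-1 d 1≤d)}} (All.lookup all-divide ℓ∈L)

      length< : length L ℕ.< q ℕ.* d
      length< = ℕ.≰⇒> (λ qd≤|L| → ℕ.<⇒≱ 2^|L|<2^qd (ℕ.^-monoʳ-≤ 2 qd≤|L|))
        where
        2^|L|<2^qd : 2 ^ length L ℕ.< 2 ^ (q ℕ.* d)
        2^|L|<2^qd = begin-strict
          2 ^ length L   ≤⟨ distinct-prime-divisors (1≤qᵈ-1 d 1≤d) L (proj₁ en) all-prime all-divide ⟩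
          q ^ d ℕ.∸ 1   <⟨ ℕ.∸-monoʳ-< (ℕ.s≤s ℕ.z≤n) (ℕ.≤-trans (1≤qᵈ-1 d 1≤d) (ℕ.m∸n≤m _ 1)) ⟩
          q ^ d ℕ.∸ 0   ≤⟨ ℕ.^-monoˡ-≤ d (ℕ.<⇒≤ (n<2^n q)) ⟩
          (2 ^ q) ^ d   ≡⟨ ℕ.^-*-assoc 2 q d ⟩
          2 ^ (q ℕ.* d) ∎
          where open ℕ.≤-Reasoning

      sumInv≤ : sumInv L ≤ inv d * X d
      sumInv≤ = ℚ.≤-trans (progression-sum d 1≤d W 1 (ℕ.s≤s ℕ.z≤n) L (proj₁ en) in-progression)
                          (*-monoˡ-≤-nonneg (inv-nonneg d) (H-mono 1 (ℕ.<⇒≤ length<)))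

    c : ℕ
    c = suc (suc q)


    C : ℚ
    C = + c / 1

    -- H_{qd} ≤ C·log₂ d, because qd < 2^q·2^(1+⌊log₂ d⌋) and H_k ≤ N whenever k < 2^N.
    X≤C·log : ∀ {d} → 2 ℕ.≤ d → X d ≤ C * (+ ⌊log₂ d ⌋ / 1)
    X≤C·log {d} 2≤d = begin
        X d                      ≤⟨ H-≤-exponent (q ℕ.+ suc n) qd<2^[q+1+n] ⟩
        + (q ℕ.+ suc n) / 1      ≤⟨ frac-≤ (q ℕ.+ suc n) 0 (c ℕ.* n) 0
                                      (ℕ.*-monoˡ-≤ 1 (a+1+n≤[2+a]*n q (1≤⌊log₂⌋ 2≤d))) ⟩
        + (c ℕ.* n) / 1          ≡⟨ sym (frac-* c 0 n 0) ⟩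
        C * (+ n / 1) ∎
      where
      open ℚ.≤-Reasoning
      n : ℕ
      n = ⌊log₂ d ⌋
      qd<2^[q+1+n] : q ℕ.* d ℕ.< 2 ^ (q ℕ.+ suc n)
      qd<2^[q+1+n] = ℕ.<-≤-trans (ℕ.*-mono-< (n<2^n q) (<2^suc⌊log₂⌋ d))
                                 (ℕ.≤-reflexive (sym (ℕ.^-distribˡ-+-* 2 q (suc n))))

    sumInv≤C·log/d : ∀ d → 2 ℕ.≤ d → (L : List ℕ) → Enumerates (InG p q d) L →
                     sumInv L ≤ C * ((+ ⌊log₂ d ⌋ / 1) * inv d)
    sumInv≤C·log/d d 2≤d L en = begin
        sumInv L                               ≤⟨ IndexSet.sumInv≤ d (ℕ.≤-trans (ℕ.s≤s ℕ.z≤n) 2≤d) L en ⟩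
        inv d * X d                            ≤⟨ *-monoˡ-≤-nonneg (inv-nonneg d) (X≤C·log 2≤d) ⟩
        inv d * (C * (+ ⌊log₂ d ⌋ / 1))
          ≡⟨ solve 3 (λ i c n → i :* (c :* n) := c :* (n :* i)) refl (inv d) C (+ ⌊log₂ d ⌋ / 1) ⟩
        C * ((+ ⌊log₂ d ⌋ / 1) * inv d) ∎
      where
      open ℚ.≤-Reasoning
      open ℚ-Solver

    C·n/d≡ : ∀ n d′ → C * ((+ n / 1) * inv (suc d′)) ≡ + (c ℕ.* n) / suc d′
    C·n/d≡ n d′ = begin
        C * ((+ n / 1) * inv (suc d′))     ≡⟨ cong (C *_) (frac-* n 0 1 d′) ⟩
        C * (+ (n ℕ.* 1) / suc (d′ ℕ.+ 0)) ≡⟨ frac-* c 0 (n ℕ.* 1) (d′ ℕ.+ 0) ⟩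
        + (c ℕ.* (n ℕ.* 1)) / suc (d′ ℕ.+ 0 ℕ.+ 0)
          ≡⟨ cong₂ (λ a b → + (c ℕ.* a) / suc b) (ℕ.*-identityʳ n) (trans (ℕ.+-identityʳ _) (ℕ.+-identityʳ d′)) ⟩
        + (c ℕ.* n) / suc d′ ∎
      where open ≡-Reasoning

    -- Part 2:  1 - g_q(d) → 0.  For ε = (a+1)/(b+1) take N = 2^(1+K) with K = 2c(b+1);
    -- then d ≥ N forces log₂ d ≥ K, hence c·log₂ d·(b+1) ≤ d.
    1-g→0 : ∀ (ε : ℚ) → 0ℚ < ε → ∃[ N ] (∀ d → d ℕ.≥ N → (L : List ℕ) → Enumerates (InG p q d) L →
            1ℚ - prodG L ≤ ε)
    1-g→0 (ℚ.mkℚ (+ zero)     _ _) (ℚ.*<* (ℤ.+<+ ()))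
    1-g→0 (ℚ.mkℚ ℤ.-[1+ _ ] _ _) (ℚ.*<* ())
    1-g→0 ε@(ℚ.mkℚ (+ suc a) b _) _ = 2 ^ suc K , small
      where
      K : ℕ
      K = 2 ℕ.* (c ℕ.* suc b)
      small : ∀ d → d ℕ.≥ 2 ^ suc K → (L : List ℕ) → Enumerates (InG p q d) L → 1ℚ - prodG L ≤ ε
      small zero      N≤0 _ _ = ⊥-elim (ℕ.<⇒≱ (ℕ.m^n>0 2 (suc K)) N≤0)
      small d@(suc d′) N≤d L en = begin
          1ℚ - prodG L                       ≤⟨ proj₂ (proj₂ (weierstrass L)) ⟩
          sumInv L                           ≤⟨ sumInv≤C·log/d d 2≤d L en ⟩
          C * ((+ n / 1) * inv d)            ≡⟨ C·n/d≡ n d′ ⟩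
          + (c ℕ.* n) / d                    ≤⟨ frac-≤ (c ℕ.* n) d′ (suc a) b cn[b+1]≤[a+1]d ⟩
          + suc a / suc b                    ≡⟨ ℚ.↥p/↧p≡p ε ⟩
          ε ∎
        where
        open ℚ.≤-Reasoning
        n : ℕ
        n = ⌊log₂ d ⌋
        2≤d : 2 ℕ.≤ d
        2≤d = ℕ.≤-trans (ℕ.^-monoʳ-≤ 2 {1} {suc K} (ℕ.s≤s ℕ.z≤n)) N≤d
        K≤n : K ℕ.≤ n
        K≤n = ℕ.≤-trans (ℕ.n≤1+n K) (subst (ℕ._≤ n) (⌊log₂[2^n]⌋≡n (suc K)) (⌊log₂⌋-mono-≤ N≤d))
        cn[b+1]≤[a+1]d : c ℕ.* n ℕ.* suc b ℕ.≤ suc a ℕ.* d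
        cn[b+1]≤[a+1]d = ℕ.≤-trans (ℕ.≤-reflexive (trans (ℕ.*-assoc c n (suc b))
                                       (trans (cong (c ℕ.*_) (ℕ.*-comm n (suc b))) (sym (ℕ.*-assoc c (suc b) n)))))
                           (ℕ.≤-trans (k*⌊log₂⌋≤ (ℕ.s≤s ℕ.z≤n) K≤n) (ℕ.m≤n*m d (suc a)))

    -- H_{q(d+1)} exceeds H_{qd} by q terms, each at most 1/(qd+1), so by at most 1/d.
    X-step : ∀ n → X (suc (suc n)) ≤ X (suc n) + inv (suc n)
    X-step n = begin
        H 1 (q ℕ.* suc (suc n))                     ≡⟨ cong (H 1) (trans (ℕ.*-suc q (suc n)) (ℕ.+-comm q _)) ⟩
        H 1 (qd ℕ.+ q)                              ≡⟨ H-split 1 qd q ⟩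
        H 1 qd + H (qd ℕ.+ 1) q                     ≡⟨ cong (λ a → H 1 qd + H a q) (ℕ.+-comm qd 1) ⟩
        H 1 qd + H (suc qd) q                       ≤⟨ ℚ.+-monoʳ-≤ (H 1 qd) (H≤k/[1+a] qd q) ⟩
        H 1 qd + + q / suc qd                       ≤⟨ ℚ.+-monoʳ-≤ (H 1 qd) q/[1+qd]≤1/d ⟩
        X (suc n) + inv (suc n) ∎
      where
      open ℚ.≤-Reasoning
      qd : ℕ
      qd = q ℕ.* suc n
      q/[1+qd]≤1/d : + q / suc qd ≤ inv (suc n)
      q/[1+qd]≤1/d = frac-≤ q qd 1 n (ℕ.≤-trans (ℕ.n≤1+n qd) (ℕ.≤-reflexive (sym (ℕ.*-identityˡ _))))

    -- Potential Φ(d) = 2(X d + 2)/d; it decreases by at least X d / d² from d to d + 1.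
    Φ : ℕ → ℚ
    Φ d = two * (inv d * (X d + two))

    -- Φ ≥ 0, so dropping the final potential bounds the partial sum.
    Φ-nonneg : ∀ d → 0ℚ ≤ Φ d
    Φ-nonneg d = *-nonneg two-nonneg (*-nonneg (inv-nonneg d) (+-nonneg (H-nonneg 1 (q ℕ.* d)) two-nonneg))

    Φ-drop : ∀ n → inv (suc n) * (inv (suc n) * X (suc n)) + Φ (suc (suc n)) ≤ Φ (suc n)
    Φ-drop n = potential-step (inv (suc n)) (inv (suc (suc n))) (X (suc n)) (X (suc (suc n)))
      (inv-nonneg (suc n)) (inv-nonneg (suc (suc n))) (H-nonneg 1 (q ℕ.* suc n)) (X-step n) (inv-telescope n) (inv≤2·inv-next n)

    term≤ : ∀ n (L : List ℕ) → Enumerates (InG p q (suc n)) L →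
            (1ℚ - prodG L) * inv (suc n) ≤ inv (suc n) * (inv (suc n) * X (suc n))
    term≤ n L en = begin
        (1ℚ - prodG L) * i     ≡⟨ ℚ.*-comm _ i ⟩
        i * (1ℚ - prodG L)     ≤⟨ *-monoˡ-≤-nonneg (inv-nonneg (suc n))
                                    (ℚ.≤-trans (proj₂ (proj₂ (weierstrass L))) (IndexSet.sumInv≤ (suc n) (ℕ.s≤s ℕ.z≤n) L en)) ⟩
        i * (i * X (suc n)) ∎
      where
      open ℚ.≤-Reasoning
      i : ℚ
      i = inv (suc n)

    telescope : ∀ (Lf : ℕ → List ℕ) → (∀ d → Enumerates (InG p q d) (Lf d)) →
                ∀ N → sumTo N (λ d → (1ℚ - prodG (Lf d)) * inv d) + Φ (suc N) ≤ Φ 1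
    telescope Lf en zero    = ℚ.≤-reflexive (ℚ.+-identityˡ (Φ 1))
    telescope Lf en (suc N) = begin
        S N + t (suc N) + Φ (suc (suc N))          ≡⟨ ℚ.+-assoc (S N) _ _ ⟩
        S N + (t (suc N) + Φ (suc (suc N)))        ≤⟨ ℚ.+-monoʳ-≤ (S N) (ℚ.+-monoˡ-≤ _ (term≤ N (Lf (suc N)) (en (suc N)))) ⟩
        S N + (X/d² + Φ (suc (suc N)))             ≤⟨ ℚ.+-monoʳ-≤ (S N) (Φ-drop N) ⟩
        S N + Φ (suc N)                            ≤⟨ telescope Lf en N ⟩
        Φ 1 ∎
      where
      open ℚ.≤-Reasoning
      t : ℕ → ℚ
      t d = (1ℚ - prodG (Lf d)) * inv d
      S : ℕ → ℚ
      S N = sumTo N t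
      X/d² : ℚ
      X/d² = inv (suc N) * (inv (suc N) * X (suc N))

    series-bounded : ∃[ B ] (∀ (Lf : ℕ → List ℕ) → (∀ d → Enumerates (InG p q d) (Lf d)) →
                     ∀ N → sumTo N (λ d → (1ℚ - prodG (Lf d)) * inv d) ≤ B)
    series-bounded = Φ 1 , bounded
      where
      bounded : ∀ (Lf : ℕ → List ℕ) → (∀ d → Enumerates (InG p q d) (Lf d)) →
                ∀ N → sumTo N (λ d → (1ℚ - prodG (Lf d)) * inv d) ≤ Φ 1
      bounded Lf en N = begin
          S                    ≡⟨ sym (ℚ.+-identityʳ S) ⟩
          S + 0ℚ               ≤⟨ ℚ.+-monoʳ-≤ S (Φ-nonneg (suc N)) ⟩
          S + Φ (suc N)        ≤⟨ telescope Lf en N ⟩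
          Φ 1 ∎
        where
        open ℚ.≤-Reasoning
        S : ℚ
        S = sumTo N (λ d → (1ℚ - prodG (Lf d)) * inv d)

open import Defs
open import Data.Nat using (ℕ; _^_; _≤_; _≥_)
open import Data.Nat.Logarithm using (⌊log₂_⌋)
open import Data.Nat.Primality using (Prime)
open import Data.Integer using (+_)
open import Data.Rational using (ℚ; _/_; _-_; _*_; _<_; 0ℚ; 1ℚ) renaming (_≤_ to _≤ℚ_)
open import Data.List using (List)
open import Data.Product using (_×_; ∃-syntax)
open import Data.Nat using (s≤s; z≤n)
open import Data.Product using (_,_)
open RationalEstimates using (frac-<; p≤q⇒0≤q-p; weierstrass)

lemma4p3 : ∀ (p m : ℕ) → Prime p → 1 ≤ m →
  ((∃[ C ] ((0ℚ < C) × (∀ (d : ℕ) → d ≥ 2 → (L : List ℕ) → Enumerates (InG p (p ^ m) d) L →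
      (0ℚ ≤ℚ (1ℚ - prodG L)) × ((1ℚ - prodG L) ≤ℚ sumInv L)
      × (sumInv L ≤ℚ (C * (((+ ⌊log₂ d ⌋) / 1) * inv d)))))))
  × (∀ (ε : ℚ) → 0ℚ < ε → ∃[ N ] (∀ (d : ℕ) → d ≥ N → (L : List ℕ) → Enumerates (InG p (p ^ m) d) L →
      (1ℚ - prodG L) ≤ℚ ε))
  × (∃[ B ] (∀ (Lf : ℕ → List ℕ) → (∀ d → Enumerates (InG p (p ^ m) d) (Lf d)) →
      ∀ (N : ℕ) → sumTo N (λ d → (1ℚ - prodG (Lf d)) * inv d) ≤ℚ B))
lemma4p3 p m prp 1≤m = (C , 0<C , per-d) , 1-g→0 , series-bounded
  where
  open Bounds.ForPrimePower p m prp 1≤m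
  0<C : 0ℚ < C
  0<C = frac-< 0 0 c 0 (s≤s z≤n)
  per-d : ∀ d → d ≥ 2 → (L : List ℕ) → Enumerates (InG p (p ^ m) d) L →
          (0ℚ ≤ℚ 1ℚ - prodG L) × (1ℚ - prodG L ≤ℚ sumInv L) × (sumInv L ≤ℚ C * ((+ ⌊log₂ d ⌋ / 1) * inv d))
  per-d d 2≤d L en with weierstrass L
  ... | _ , g≤1 , 1-g≤Σ = p≤q⇒0≤q-p g≤1 , 1-g≤Σ , sumInv≤C·log/d d 2≤d L en
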